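{- Let $m\geqslant 2$ be an integer, let $w$ be an integer with $m\leqslant w\leqslant 2m-1$, and let $z=km+l$ with $k$ a positive integer and $0\leqslant l\leqslant m-1$. If $k\geqslant 5m$, then $b_m(w)\,b_m(z)>b_m(w+z)$.
   Context: For an integer $m\geqslant2$, the $m$-ary partition function $b_m(n)$ is the number of partitions of $n$ all of whose parts are powers of $m$, i.e. belong to $\{m^i: i\in\mathbb{N}\}=\{1,m,m^2,\ldots\}$. -}

module Defs where

open import Data.Nat using (ℕ; zero; suc; _+_; _*_; _∸_; _^_; _≤ᵇ_)
open import Data.Bool using (if_then_else_)

-- count m j n : number of partitions of n all of whose parts lie in
-- {m^0, m^1, ..., m^j}.
-- j = 0: only the part 1 is allowed, so exactly one partition.
-- j+1: sum over the multiplicity t ≥ 0 of the largest part m^(j+1)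
--      (with t * m^(j+1) ≤ n) of count m j (n - t * m^(j+1)).
count : ℕ → ℕ → ℕ → ℕ
count m zero    n = 1
count m (suc j) n = go n
  where
  go : ℕ → ℕ
  go zero    = count m j n
  go (suc t) = go t + (if suc t * m ^ suc j ≤ᵇ n
                       then count m j (n ∸ suc t * m ^ suc j)
                       else 0)

-- For m ≥ 2 every power of m that can occur as a part of n is m^i with
-- i ≤ n (since m^i ≥ 2^i > i), so allowing parts m^0, ..., m^n suffices.
b : ℕ → ℕ → ℕ
b m n = count m n n

{-# OPTIONS --safe #-}
module Submission where

open import Defs
open import Data.Bool using (if_then_else_)
open import Data.Nat
  using (ℕ; zero; suc; _+_; _*_; _∸_; _^_; _≤_; _<_; _>_; _≥_; _≤ᵇ_; z≤n; s≤s; z<s; NonZero; >-nonZero)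
open import Data.Nat.DivMod using (_/_; _%_; m≡m%n+[m/n]*n; m%n<n; /-monoˡ-≤; m<n*o⇒m/o<n)
open import Data.Nat.Properties
open import Data.Nat.Induction using (<-rec)
open import Data.Sum using (inj₁; inj₂)
open import Algebra.Properties.CommutativeSemigroup +-commutativeSemigroup using (interchange)
open import Relation.Binary.PropositionalEquality
open import Data.Nat.Tactic.RingSolver using (solve-∀)

-- Write P_j(n) = count m j n for partitions into parts m^0, …, m^j. Splitting off the copies
-- of the largest part gives P_{j+1}(n) = P_j(n) + P_{j+1}(n − m^{j+1}), the last term being 0
-- for n < m^{j+1}. For r < m, both a ↦ P_{j+1}(a m + r) and a ↦ Σ_{i≤a} P_j(i) solve the same
-- recurrence of this shape, so they agree, and letting j grow gives b(a m + r) = Σ_{i≤a} b(i).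
-- Hence b(w) = 2, b(k m + l) = Σ_{i≤k} b(i) and b(w + k m + l) ≤ Σ_{i≤k+2} b(i), and it remains
-- to show b(k+1) + b(k+2) < Σ_{i≤k} b(i). The same identity gives b(n+2) ≤ b(n) + b(⌊n/m⌋ + 1);
-- at n = k−1 and n = k the last terms are at most b(k−3) and b(k−2), and b(0) = 1 makes the
-- inequality strict.

delay : ℕ → (ℕ → ℕ) → ℕ → ℕ
delay zero    g n       = g n
delay (suc M) g zero    = 0
delay (suc M) g (suc n) = delay M g n

delay-+ : ∀ M g n → delay M g (M + n) ≡ g n
delay-+ zero    g n = refl
delay-+ (suc M) g n = delay-+ M g n

delay-< : ∀ M g {n} → n < M → delay M g n ≡ 0
delay-< (suc M) g {zero}  _         = refl
delay-< (suc M) g {suc n} (s≤s n<M) = delay-< M g n<M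

delay-delay : ∀ M N g n → delay M (delay N g) n ≡ delay (M + N) g n
delay-delay zero    N g n       = refl
delay-delay (suc M) N g zero    = refl
delay-delay (suc M) N g (suc n) = delay-delay M N g n

delay-≤ᵇ : ∀ M g n → delay M g n ≡ (if M ≤ᵇ n then g (n ∸ M) else 0)
delay-≤ᵇ zero          g n       = refl
delay-≤ᵇ (suc M)       g zero    = refl
delay-≤ᵇ (suc zero)    g (suc n) = refl
delay-≤ᵇ (suc (suc M)) g (suc n) = delay-≤ᵇ (suc M) g n

delay-cong : ∀ M {g h} n → (∀ x → x + M ≡ n → g x ≡ h x) → delay M g n ≡ delay M h n
delay-cong zero    n       eq = eq n (+-identityʳ n)
delay-cong (suc M) zero    eq = refl
delay-cong (suc M) (suc n) eq = delay-cong M n (λ x x+M≡n → eq x (trans (+-suc x M) (cong suc x+M≡n)))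

delay-* : ∀ M {m r} f a → r < m → delay (M * m) f (a * m + r) ≡ delay M (λ a → f (a * m + r)) a
delay-* zero    f a       r<m = refl
delay-* (suc M) {m} {r} f zero r<m = delay-< (m + M * m) f (≤-trans r<m (m≤m+n m (M * m)))
delay-* (suc M) {m} {r} f (suc a) r<m = begin
  delay (m + M * m) f ((m + a * m) + r)   ≡⟨ cong (delay (m + M * m) f) (+-assoc m (a * m) r) ⟩
  delay (m + M * m) f (m + (a * m + r))   ≡⟨ delay-delay m (M * m) f _ ⟨
  delay m (delay (M * m) f) (m + (a * m + r)) ≡⟨ delay-+ m (delay (M * m) f) (a * m + r) ⟩
  delay (M * m) f (a * m + r)             ≡⟨ delay-* M f a r<m ⟩
  delay M (λ a → f (a * m + r)) a         ∎
  where open ≡-Reasoning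

delay-fixpoint-unique : ∀ {M} → 0 < M → ∀ {g X Y : ℕ → ℕ} →
  (∀ n → X n ≡ g n + delay M X n) → (∀ n → Y n ≡ g n + delay M Y n) → ∀ n → X n ≡ Y n
delay-fixpoint-unique {suc M} _ {g} {X} {Y} X-rec Y-rec = <-rec (λ n → X n ≡ Y n) step
  where
  step : ∀ n → (∀ {x} → x < n → X x ≡ Y x) → X n ≡ Y n
  step n ih = begin
    X n                     ≡⟨ X-rec n ⟩
    g n + delay (suc M) X n ≡⟨ cong (g n +_) (delay-cong (suc M) n λ x x+M≡n → ih (below x+M≡n)) ⟩
    g n + delay (suc M) Y n ≡⟨ Y-rec n ⟨
    Y n                     ∎
    where
    open ≡-Reasoning
    below : ∀ {x} → x + suc M ≡ n → x < n
    below {x} refl = m<m+n x z<s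

prefixSum : (ℕ → ℕ) → ℕ → ℕ
prefixSum f zero    = f 0
prefixSum f (suc a) = prefixSum f a + f (suc a)

prefixSum-unique : ∀ {f} (g : ℕ → ℕ) → g 0 ≡ f 0 → (∀ t → g (suc t) ≡ g t + f (suc t)) →
  ∀ t → g t ≡ prefixSum f t
prefixSum-unique g g0 gs zero    = g0
prefixSum-unique {f} g g0 gs (suc t) = trans (gs t) (cong (_+ f (suc t)) (prefixSum-unique g g0 gs t))

prefixSum-cong : ∀ {f g} a → (∀ i → i ≤ a → f i ≡ g i) → prefixSum f a ≡ prefixSum g a
prefixSum-cong zero    eq = eq 0 z≤n
prefixSum-cong (suc a) eq =
  cong₂ _+_ (prefixSum-cong a (λ i i≤a → eq i (m≤n⇒m≤1+n i≤a))) (eq (suc a) ≤-refl)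

prefixSum-mono : ∀ f {a c} → a ≤ c → prefixSum f a ≤ prefixSum f c
prefixSum-mono f {a} {c} a≤c with m≤n⇒m<n∨m≡n a≤c
... | inj₂ refl = ≤-refl
prefixSum-mono f {a} {suc c} _ | inj₁ (s≤s a≤c) = ≤-trans (prefixSum-mono f a≤c) (m≤m+n _ _)

f0≤prefixSum : ∀ f a → f 0 ≤ prefixSum f a
f0≤prefixSum f a = prefixSum-mono f {0} {a} z≤n

prefixSum-+ : ∀ f g a → prefixSum (λ i → f i + g i) a ≡ prefixSum f a + prefixSum g a
prefixSum-+ f g zero    = refl
prefixSum-+ f g (suc a) = begin
  prefixSum (λ i → f i + g i) a + (f (suc a) + g (suc a))
    ≡⟨ cong (_+ (f (suc a) + g (suc a))) (prefixSum-+ f g a) ⟩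
  (prefixSum f a + prefixSum g a) + (f (suc a) + g (suc a))
    ≡⟨ interchange (prefixSum f a) (prefixSum g a) (f (suc a)) (g (suc a)) ⟩
  (prefixSum f a + f (suc a)) + (prefixSum g a + g (suc a))
    ∎
  where open ≡-Reasoning

prefixSum-suc : ∀ f a → prefixSum f (suc a) ≡ f 0 + prefixSum (λ i → f (suc i)) a
prefixSum-suc f zero    = refl
prefixSum-suc f (suc a) = trans (cong (_+ f (suc (suc a))) (prefixSum-suc f a)) (+-assoc (f 0) _ _)

prefixSum-tail : ∀ f {a T} → a ≤ T → (∀ i → a < i → f i ≡ 0) → prefixSum f T ≡ prefixSum f a
prefixSum-tail f {a} {T} a≤T vanish with m≤n⇒m<n∨m≡n a≤T
... | inj₂ refl = refl
prefixSum-tail f {a} {suc T} _ vanish | inj₁ (s≤s a≤T) = begin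
  prefixSum f T + f (suc T) ≡⟨ cong₂ _+_ (prefixSum-tail f a≤T vanish) (vanish (suc T) (s≤s a≤T)) ⟩
  prefixSum f a + 0         ≡⟨ +-identityʳ _ ⟩
  prefixSum f a             ∎
  where open ≡-Reasoning

prefixSum-zero : ∀ T → prefixSum (λ _ → 0) T ≡ 0
prefixSum-zero zero    = refl
prefixSum-zero (suc T) = trans (+-identityʳ _) (prefixSum-zero T)

prefixSum-delay : ∀ M g a → prefixSum (delay M g) a ≡ delay M (prefixSum g) a
prefixSum-delay zero    g a       = refl
prefixSum-delay (suc M) g zero    = refl
prefixSum-delay (suc M) g (suc a) = trans (prefixSum-suc (delay (suc M) g) a) (prefixSum-delay M g a)

delay-prefixSum : ∀ M (h : ℕ → ℕ → ℕ) T n →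
  delay M (λ x → prefixSum (λ s → h s x) T) n ≡ prefixSum (λ s → delay M (h s) n) T
delay-prefixSum zero    h T n       = refl
delay-prefixSum (suc M) h T zero    = sym (prefixSum-zero T)
delay-prefixSum (suc M) h T (suc n) = delay-prefixSum M h T n

sumOverMultiples : ℕ → (ℕ → ℕ) → ℕ → ℕ
sumOverMultiples M f n = prefixSum (λ s → delay (s * M) f n) n

sumOverMultiples-rec : ∀ {M} → 0 < M → ∀ f n →
  sumOverMultiples M f n ≡ f n + delay M (sumOverMultiples M f) n
sumOverMultiples-rec {suc M} _ f zero    = sym (+-identityʳ (f 0))
sumOverMultiples-rec {M@(suc _)} _ f (suc n) = begin
  prefixSum (λ s → delay (s * M) f (suc n)) (suc n)
    ≡⟨ prefixSum-suc _ n ⟩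
  f (suc n) + prefixSum (λ s → delay (M + s * M) f (suc n)) n
    ≡⟨ cong (f (suc n) +_) (prefixSum-cong n λ s _ → sym (delay-delay M (s * M) f (suc n))) ⟩
  f (suc n) + prefixSum (λ s → delay M (delay (s * M) f) (suc n)) n
    ≡⟨ cong (f (suc n) +_) (delay-prefixSum M (λ s → delay (s * M) f) n (suc n)) ⟨
  f (suc n) + delay M (λ x → prefixSum (λ s → delay (s * M) f x) n) (suc n)
    ≡⟨ cong (f (suc n) +_) (delay-cong M (suc n) λ x x+M≡1+n → truncate (below x+M≡1+n)) ⟩
  f (suc n) + delay M (sumOverMultiples M f) (suc n)
    ∎
  where
  open ≡-Reasoning
  below : ∀ {x} → x + M ≡ suc n → x ≤ n
  below {x} x+M≡1+n = ≤-pred (subst (x <_) x+M≡1+n (m<m+n x z<s))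
  truncate : ∀ {x} → x ≤ n → prefixSum (λ s → delay (s * M) f x) n ≡ sumOverMultiples M f x
  truncate {x} x≤n = prefixSum-tail _ x≤n λ s x<s → delay-< (s * M) f (<-≤-trans x<s (m≤m*n s M))

-- The inner sum of count is where-bound and cannot be named. Abstracting n and suc n
-- separately exposes it as a function of two independent variables, which then solves the
-- metavariable g of prefixSum-unique, created in the context m j only.
count-suc≡sumOverMultiples : ∀ m j n → count m (suc j) n ≡ sumOverMultiples (m ^ suc j) (count m j) n
count-suc≡sumOverMultiples m j
  with (λ K → prefixSum-unique _ refl λ t →
                cong₂ _+_ refl (sym (delay-≤ᵇ (suc t * m ^ suc j) (count m j) K)))
... | inner≡prefixSum = from-inner
  where
  from-inner : ∀ n → count m (suc j) n ≡ sumOverMultiples (m ^ suc j) (count m j) n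
  from-inner zero = refl
  from-inner (suc n) with n | suc n
  ... | t | K = cong₂ _+_ (inner≡prefixSum K t) (sym (delay-≤ᵇ (suc t * m ^ suc j) (count m j) K))

count-suc : ∀ m .{{_ : NonZero m}} j n →
  count m (suc j) n ≡ count m j n + delay (m ^ suc j) (count m (suc j)) n
count-suc m j n = begin
  count m (suc j) n
    ≡⟨ count-suc≡sumOverMultiples m j n ⟩
  sumOverMultiples M (count m j) n
    ≡⟨ sumOverMultiples-rec (m^n>0 m (suc j)) (count m j) n ⟩
  count m j n + delay M (sumOverMultiples M (count m j)) n
    ≡⟨ cong (count m j n +_) (delay-cong M n λ x _ → count-suc≡sumOverMultiples m j x) ⟨
  count m j n + delay M (count m (suc j)) n
    ∎
  where
  open ≡-Reasoning
  M = m ^ suc j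

count-suc-digits : ∀ m .{{_ : NonZero m}} j {r} → r < m → ∀ a →
  count m (suc j) (a * m + r) ≡
  count m j (a * m + r) + delay (m ^ j) (λ a → count m (suc j) (a * m + r)) a
count-suc-digits m j {r} r<m a = begin
  count m (suc j) (a * m + r)
    ≡⟨ count-suc m j (a * m + r) ⟩
  count m j (a * m + r) + delay (m * m ^ j) (count m (suc j)) (a * m + r)
    ≡⟨ cong (λ M → count m j (a * m + r) + delay M (count m (suc j)) (a * m + r)) (*-comm m (m ^ j)) ⟩
  count m j (a * m + r) + delay (m ^ j * m) (count m (suc j)) (a * m + r)
    ≡⟨ cong (count m j (a * m + r) +_) (delay-* (m ^ j) (count m (suc j)) a r<m) ⟩
  count m j (a * m + r) + delay (m ^ j) (λ a → count m (suc j) (a * m + r)) a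
    ∎
  where open ≡-Reasoning

prefixSum-rec : ∀ f a → prefixSum f a ≡ f a + delay 1 (prefixSum f) a
prefixSum-rec f zero    = sym (+-identityʳ (f 0))
prefixSum-rec f (suc a) = +-comm (prefixSum f a) (f (suc a))

prefixSum-count-suc : ∀ m .{{_ : NonZero m}} j a →
  prefixSum (count m (suc j)) a ≡
  prefixSum (count m j) a + delay (m ^ suc j) (prefixSum (count m (suc j))) a
prefixSum-count-suc m j a = begin
  prefixSum (count m (suc j)) a
    ≡⟨ prefixSum-cong a (λ i _ → count-suc m j i) ⟩
  prefixSum (λ i → count m j i + delay M (count m (suc j)) i) a
    ≡⟨ prefixSum-+ (count m j) (delay M (count m (suc j))) a ⟩
  prefixSum (count m j) a + prefixSum (delay M (count m (suc j))) a
    ≡⟨ cong (prefixSum (count m j) a +_) (prefixSum-delay M (count m (suc j)) a) ⟩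
  prefixSum (count m j) a + delay M (prefixSum (count m (suc j))) a
    ∎
  where
  open ≡-Reasoning
  M = m ^ suc j

count-digits : ∀ m .{{_ : NonZero m}} j {r} → r < m → ∀ a →
  count m (suc j) (a * m + r) ≡ prefixSum (count m j) a
count-digits m zero    r<m = delay-fixpoint-unique z<s (count-suc-digits m 0 r<m) (prefixSum-rec (count m 0))
count-digits m (suc j) r<m = delay-fixpoint-unique (m^n>0 m (suc j)) (count-suc-digits m (suc j) r<m)
  λ a → trans (prefixSum-count-suc m j a) (cong (_+ _) (sym (count-digits m j r<m a)))

count-stable : ∀ m .{{_ : NonZero m}} {J n} → n < m ^ suc J → count m (suc J) n ≡ count m J n
count-stable m {J} {n} n<M = begin
  count m (suc J) n                                      ≡⟨ count-suc m J n ⟩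
  count m J n + delay (m ^ suc J) (count m (suc J)) n   ≡⟨ cong (count m J n +_) (delay-< _ _ n<M) ⟩
  count m J n + 0                                        ≡⟨ +-identityʳ _ ⟩
  count m J n                                            ∎
  where open ≡-Reasoning

module _ {m : ℕ} (1<m : 1 < m) where

  private
    instance
      m-nonZero : NonZero m
      m-nonZero = >-nonZero (<-trans z<s 1<m)

  n<m^n : ∀ n → n < m ^ n
  n<m^n zero    = z<s
  n<m^n (suc n) = begin-strict
    suc n         ≤⟨ n<m^n n ⟩
    m ^ n         <⟨ m<m+n (m ^ n) (m^n>0 m n) ⟩
    m ^ n + m ^ n ≡⟨ cong (m ^ n +_) (+-identityʳ (m ^ n)) ⟨
    2 * m ^ n     ≤⟨ *-monoˡ-≤ (m ^ n) 1<m ⟩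
    m * m ^ n     ∎
    where open ≤-Reasoning

  count≡b : ∀ {J n} → n ≤ J → count m J n ≡ b m n
  count≡b {J} {n} n≤J with m≤n⇒m<n∨m≡n n≤J
  ... | inj₂ refl = refl
  count≡b {suc J} {n} _ | inj₁ (s≤s n≤J) =
    trans (count-stable m (<-≤-trans (n<m^n n) (^-monoʳ-≤ m (m≤n⇒m≤1+n n≤J)))) (count≡b n≤J)

  b-digits : ∀ {r} → r < m → ∀ a → b m (a * m + r) ≡ prefixSum (b m) a
  b-digits {r} r<m a = begin
    b m n                         ≡⟨ count≡b (n≤1+n n) ⟨
    count m (suc n) n             ≡⟨ count-digits m n r<m a ⟩
    prefixSum (count m n) a       ≡⟨ prefixSum-cong a (λ i i≤a → count≡b (≤-trans i≤a a≤n)) ⟩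
    prefixSum (b m) a             ∎
    where
    open ≡-Reasoning
    n = a * m + r
    a≤n : a ≤ n
    a≤n = ≤-trans (m≤m*n a m) (m≤m+n (a * m) r)

  b≡prefixSum[/] : ∀ n → b m n ≡ prefixSum (b m) (n / m)
  b≡prefixSum[/] n = begin
    b m n                           ≡⟨ cong (b m) (trans (m≡m%n+[m/n]*n n m) (+-comm (n % m) _)) ⟩
    b m (n / m * m + n % m)         ≡⟨ b-digits (m%n<n n m) (n / m) ⟩
    prefixSum (b m) (n / m)         ∎
    where open ≡-Reasoning

  b-mono : ∀ {x y} → x ≤ y → b m x ≤ b m y
  b-mono {x} {y} x≤y = subst₂ _≤_ (sym (b≡prefixSum[/] x)) (sym (b≡prefixSum[/] y))
    (prefixSum-mono (b m) (/-monoˡ-≤ m x≤y))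

  b≤prefixSum : ∀ {n c} → n < suc c * m → b m n ≤ prefixSum (b m) c
  b≤prefixSum {n} {c} n<[1+c]m = subst (_≤ prefixSum (b m) c) (sym (b≡prefixSum[/] n))
    (prefixSum-mono (b m) (≤-pred (m<n*o⇒m/o<n {n} {suc c} n<[1+c]m)))

  b[2+n]≤b[n]+b[c] : ∀ {n c} → n < c * m → b m (2 + n) ≤ b m n + b m c
  b[2+n]≤b[n]+b[c] {n} {c} n<cm = begin
    b m (2 + n)                       ≤⟨ b≤prefixSum {c = suc q} 2+n<[2+q]m ⟩
    prefixSum (b m) q + b m (suc q)   ≡⟨ cong (_+ b m (suc q)) (b≡prefixSum[/] n) ⟨
    b m n + b m (suc q)               ≤⟨ +-monoʳ-≤ (b m n) (b-mono (m<n*o⇒m/o<n {n} {c} n<cm)) ⟩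
    b m n + b m c                     ∎
    where
    open ≤-Reasoning
    q = n / m
    2+n<[2+q]m : 2 + n < suc (suc q) * m
    2+n<[2+q]m = begin-strict
      2 + n                 ≡⟨ cong (2 +_) (m≡m%n+[m/n]*n n m) ⟩
      2 + (n % m + q * m)   <⟨ +-monoʳ-< 2 (+-monoˡ-< (q * m) (m%n<n n m)) ⟩
      2 + (m + q * m)       ≤⟨ +-monoˡ-≤ (m + q * m) 1<m ⟩
      m + (m + q * m)       ∎

  b[4+c]≤b[2+c]+b[c] : ∀ {c} → 3 ≤ c → b m (4 + c) ≤ b m (2 + c) + b m c
  b[4+c]≤b[2+c]+b[c] {c@(suc (suc (suc c')))} (s≤s (s≤s (s≤s z≤n))) = b[2+n]≤b[n]+b[c] 2+c<c*m
    where
    open ≤-Reasoning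
    2+c<c*m : 2 + c < c * m
    2+c<c*m = begin-strict
      2 + c   <⟨ +-monoʳ-≤ 6 (m≤m*n c' 2) ⟩
      c * 2   ≤⟨ *-monoʳ-≤ c 1<m ⟩
      c * m   ∎

  b[1+k]+b[2+k]<prefixSum : ∀ {k} → 6 ≤ k → b m (1 + k) + b m (2 + k) < prefixSum (b m) k
  b[1+k]+b[2+k]<prefixSum {suc (suc (suc (suc k')))} (s≤s (s≤s (s≤s (s≤s 2≤k')))) = begin-strict
    B (5 + k') + B (6 + k')
      ≤⟨ +-mono-≤ (b[4+c]≤b[2+c]+b[c] (s≤s 2≤k')) (b[4+c]≤b[2+c]+b[c] (s≤s (m≤n⇒m≤1+n 2≤k'))) ⟩
    (B (3 + k') + B (1 + k')) + (B (4 + k') + B (2 + k'))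
      <⟨ m<n+m _ (f0≤prefixSum B k') ⟩
    S k' + ((B (3 + k') + B (1 + k')) + (B (4 + k') + B (2 + k')))
      ≡⟨ rearrange (S k') (B (1 + k')) (B (2 + k')) (B (3 + k')) (B (4 + k')) ⟩
    S (4 + k')
      ∎
    where
    open ≤-Reasoning
    B = b m
    S = prefixSum B
    rearrange : ∀ s x₁ x₂ x₃ x₄ → s + ((x₃ + x₁) + (x₄ + x₂)) ≡ (((s + x₁) + x₂) + x₃) + x₄
    rearrange = solve-∀

  m≤w<2m⇒b≡2 : ∀ {w} → m ≤ w → w < 2 * m → b m w ≡ 2
  m≤w<2m⇒b≡2 {w} m≤w w<2m = begin
    b m w             ≡⟨ cong (b m) (trans (sym (m+[n∸m]≡n m≤w)) (cong (_+ d) (sym (*-identityˡ m)))) ⟩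
    b m (1 * m + d)   ≡⟨ b-digits d<m 1 ⟩
    1 + b m 1         ≡⟨ cong (1 +_) (b-digits 1<m 0) ⟩
    2                 ∎
    where
    open ≡-Reasoning
    d = w ∸ m
    d<m : d < m
    d<m = +-cancelˡ-< m d m (subst₂ _<_ (sym (m+[n∸m]≡n m≤w)) (cong (m +_) (+-identityʳ m)) w<2m)

w+[k*m+l]<[3+k]*m : ∀ {m w l} k → w < 2 * m → l < m → w + (k * m + l) < (3 + k) * m
w+[k*m+l]<[3+k]*m {m} {w} {l} k w<2m l<m = begin-strict
  w + (k * m + l)       <⟨ +-monoʳ-< w (+-monoʳ-< (k * m) l<m) ⟩
  w + (k * m + m)       ≤⟨ +-monoˡ-≤ (k * m + m) (<⇒≤ w<2m) ⟩
  2 * m + (k * m + m)   ≡⟨ rearrange m k ⟩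
  (3 + k) * m           ∎
  where
  open ≤-Reasoning
  rearrange : ∀ m k → 2 * m + (k * m + m) ≡ (3 + k) * m
  rearrange = solve-∀

lemma4p1 : (m w k l : ℕ) → 2 ≤ m → m ≤ w → w ≤ 2 * m ∸ 1 → 1 ≤ k → l ≤ m ∸ 1 →
    k ≥ 5 * m → b m w * b m (k * m + l) > b m (w + (k * m + l))
lemma4p1 m@(suc _) w k l 1<m m≤w w≤2m∸1 _ l≤m∸1 k≥5m = begin-strict
  b m (w + (k * m + l))               ≤⟨ b≤prefixSum 1<m {c = 2 + k} (w+[k*m+l]<[3+k]*m k w<2m l<m) ⟩
  S k + b m (1 + k) + b m (2 + k)     ≡⟨ +-assoc (S k) _ _ ⟩
  S k + (b m (1 + k) + b m (2 + k))   <⟨ +-monoʳ-< (S k) (b[1+k]+b[2+k]<prefixSum 1<m 6≤k) ⟩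
  S k + S k                           ≡⟨ cong (S k +_) (+-identityʳ (S k)) ⟨
  2 * S k                             ≡⟨ cong₂ _*_ (m≤w<2m⇒b≡2 1<m m≤w w<2m) (b-digits 1<m l<m k) ⟨
  b m w * b m (k * m + l)             ∎
  where
  open ≤-Reasoning
  S = prefixSum (b m)
  w<2m = s≤s w≤2m∸1
  l<m = s≤s l≤m∸1
  6≤k = ≤-trans (m≤m+n 6 4) (≤-trans (*-monoʳ-≤ 5 1<m) k≥5m)
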